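{- Let $G$ be a finite simple graph with $G \in ER(n,d,3)$ (for some $n,d$), and suppose $G$ has a uniform shared neighborhood structure. Then this uniform shared neighborhood structure is not isomorphic to the path $P_3$.
   Context: For a finite simple graph $G$ and a vertex $u$, $N(u)$ denotes the open neighborhood of $u$. $G \in ER(n,d,\lambda)$ means $G$ is edge-regular: $G$ has $n$ vertices, is regular of degree $d$, and every pair of adjacent vertices has exactly $\lambda$ common neighbors. $G$ has a uniform shared neighborhood structure (USNS) isomorphic to a graph $H$ if the induced subgraph $G[N(u)\cap N(v)]$ is isomorphic to $H$ for every pair of adjacent vertices $u \sim v$ of $G$. $P_m$ denotes the path graph on $m$ vertices. -}

module Defs where

open import Data.Nat using (ℕ)
open import Data.Bool using (Bool; true; false; _∧_)
open import Data.Fin using (Fin; zero; suc)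
open import Data.Fin.Subset using (Subset; ∣_∣)
open import Data.Vec using (tabulate; lookup)
open import Data.Product using (Σ; ∃; _×_; _,_)
open import Relation.Binary.PropositionalEquality using (_≡_)
open import Function.Definitions using (Injective)

record Graph (n : ℕ) : Set where
  field
    adj   : Fin n → Fin n → Bool
    sym   : ∀ u v → adj u v ≡ adj v u
    irrefl : ∀ u → adj u u ≡ false

open Graph public

_∼[_]_ : ∀ {n} → Fin n → Graph n → Fin n → Set
u ∼[ G ] v = adj G u v ≡ true

N : ∀ {n} → Graph n → Fin n → Subset n
N G u = tabulate (λ w → adj G u w)

common : ∀ {n} → Graph n → Fin n → Fin n → Subset n
common G u v = tabulate (λ w → adj G u w ∧ adj G v w)

EdgeRegular : ∀ {n} → Graph n → ℕ → ℕ → Set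
EdgeRegular {n} G d λ' =
  (∀ u → ∣ N G u ∣ ≡ d) ×
  (∀ u v → u ∼[ G ] v → ∣ common G u v ∣ ≡ λ')

_≅_ : ∀ {k m} → Graph k → Graph m → Set
_≅_ {k} {m} H H' =
  Σ (Fin k → Fin m) λ f → Σ (Fin m → Fin k) λ g →
    (∀ i → g (f i) ≡ i) × (∀ j → f (g j) ≡ j) ×
    (∀ i j → adj H' (f i) (f j) ≡ adj H i j)

InducedIso : ∀ {n k} → Graph n → Subset n → Graph k → Set
InducedIso {n} {k} G S H =
  Σ (Fin k → Fin n) λ f →
    Injective _≡_ _≡_ f ×
    (∀ i → lookup S (f i) ≡ true) ×
    (∀ w → lookup S w ≡ true → ∃ λ i → f i ≡ w) ×
    (∀ i j → adj G (f i) (f j) ≡ adj H i j)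

USNS : ∀ {n k} → Graph n → Graph k → Set
USNS G H = ∀ u v → u ∼[ G ] v → InducedIso G (common G u v) H

P3adj : Fin 3 → Fin 3 → Bool
P3adj zero (suc zero) = true
P3adj (suc zero) zero = true
P3adj (suc zero) (suc (suc zero)) = true
P3adj (suc (suc zero)) (suc zero) = true
P3adj _ _ = false

P3 : Graph 3
P3 = record { adj = P3adj ; sym = s ; irrefl = r }
  where
  s : ∀ u v → P3adj u v ≡ P3adj v u
  s zero zero = _≡_.refl
  s zero (suc zero) = _≡_.refl
  s zero (suc (suc zero)) = _≡_.refl
  s (suc zero) zero = _≡_.refl
  s (suc zero) (suc zero) = _≡_.refl
  s (suc zero) (suc (suc zero)) = _≡_.refl
  s (suc (suc zero)) zero = _≡_.refl
  s (suc (suc zero)) (suc zero) = _≡_.refl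
  s (suc (suc zero)) (suc (suc zero)) = _≡_.refl
  r : ∀ u → P3adj u u ≡ false
  r zero = _≡_.refl
  r (suc zero) = _≡_.refl
  r (suc (suc zero)) = _≡_.refl

{-# OPTIONS --safe #-}
-- Suppose u ∼ v and N(u) ∩ N(v) induces the path a – b – c. The edge v – b lies
-- inside N(u) ∩ N(a), which also induces a P₃, so some x ∈ N(u) ∩ N(a) other than
-- v and b is adjacent to v or to b. If x ∼ v then a, b, c, x are four common
-- neighbours of u and v; if x ∼ b then v, a, c, x are four common neighbours of u
-- and b. Both contradict the shared neighbourhoods having three vertices.
module Submission where

open import Defs hiding (sym)
open import Data.Nat using (ℕ; _≤_)
open import Data.Nat.Properties using (1+n≰n)
open import Data.Empty using (⊥)
open import Data.Bool using (true; false; _∧_)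
open import Data.Bool.Properties using (∧-conicalˡ; ∧-conicalʳ)
open import Data.Fin using (Fin; zero; suc)
open import Data.Fin.Properties using (injective⇒≤)
open import Data.Fin.Subset using (Subset)
open import Data.Vec using (lookup)
open import Data.Vec.Properties using (lookup∘tabulate)
open import Data.List as List using (List; length)
open import Data.List.Membership.Propositional.Properties using (∈-lookup)
open import Data.List.Relation.Unary.All as All using (All; []; _∷_)
open import Data.List.Relation.Unary.AllPairs using ([]; _∷_)
open import Data.List.Relation.Unary.Unique.Propositional using (Unique)
open import Data.Product using (∃; ∃₂; _×_; _,_; proj₁; proj₂)
open import Data.Sum as Sum using (_⊎_; [_,_]′)
open import Function using (_∘_)
open import Function.Definitions using (Injective)
open import Relation.Nullary using (¬_; contradiction)
open import Relation.Binary.PropositionalEquality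
  using (_≡_; _≢_; refl; sym; trans; cong; cong₂; ≢-sym; module ≡-Reasoning)

Unique⇒lookup-injective : ∀ {a} {A : Set a} {xs : List A} →
  Unique xs → Injective _≡_ _≡_ (List.lookup xs)
Unique⇒lookup-injective (_ ∷ _)         {zero}  {zero}  _  = refl
Unique⇒lookup-injective (x∉xs ∷ _)      {zero}  {suc j} eq =
  contradiction eq (All.lookup x∉xs (∈-lookup j))
Unique⇒lookup-injective (x∉xs ∷ _)      {suc i} {zero}  eq =
  contradiction (sym eq) (All.lookup x∉xs (∈-lookup i))
Unique⇒lookup-injective (_ ∷ xs-unique) {suc i} {suc j} eq =
  cong suc (Unique⇒lookup-injective xs-unique eq)

P3-edge-has-neighbour : ∀ i j → P3adj i j ≡ true →
  ∃ λ m → m ≢ i × m ≢ j × (P3adj i m ≡ true ⊎ P3adj j m ≡ true)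
P3-edge-has-neighbour zero (suc zero) _ =
  suc (suc zero) , (λ ()) , (λ ()) , Sum.inj₂ refl
P3-edge-has-neighbour (suc zero) zero _ =
  suc (suc zero) , (λ ()) , (λ ()) , Sum.inj₁ refl
P3-edge-has-neighbour (suc zero) (suc (suc zero)) _ =
  zero , (λ ()) , (λ ()) , Sum.inj₁ refl
P3-edge-has-neighbour (suc (suc zero)) (suc zero) _ =
  zero , (λ ()) , (λ ()) , Sum.inj₂ refl
P3-edge-has-neighbour zero zero ()
P3-edge-has-neighbour zero (suc (suc zero)) ()
P3-edge-has-neighbour (suc zero) (suc zero) ()
P3-edge-has-neighbour (suc (suc zero)) zero ()
P3-edge-has-neighbour (suc (suc zero)) (suc (suc zero)) ()

module _ {n : ℕ} (G : Graph n) where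

  ∼-sym : ∀ {u v} → u ∼[ G ] v → v ∼[ G ] u
  ∼-sym {u} {v} u∼v = trans (Graph.sym G v u) u∼v

  ∼⇒≢ : ∀ {u v} → u ∼[ G ] v → u ≢ v
  ∼⇒≢ {u} u∼v refl = contradiction (trans (sym u∼v) (irrefl G u)) λ ()

  ≁-∼⇒≢ : ∀ {u v w} → adj G u v ≡ false → u ∼[ G ] w → v ≢ w
  ≁-∼⇒≢ u≁v u∼w refl = contradiction (trans (sym u∼w) u≁v) λ ()

  ∈-common⁺ : ∀ {u v w} → u ∼[ G ] w → v ∼[ G ] w → lookup (common G u v) w ≡ true
  ∈-common⁺ {w = w} u∼w v∼w = trans (lookup∘tabulate _ w) (cong₂ _∧_ u∼w v∼w)

  ∈-common⁻ : ∀ {u v w} → lookup (common G u v) w ≡ true → u ∼[ G ] w × v ∼[ G ] w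
  ∈-common⁻ {u} {v} {w} w∈common =
    ∧-conicalˡ (adj G u w) (adj G v w) uw∧vw , ∧-conicalʳ (adj G u w) (adj G v w) uw∧vw
    where uw∧vw = trans (sym (lookup∘tabulate _ w)) w∈common

  InducedIso-resp-≅ : ∀ {k m} {S : Subset n} {H : Graph k} {H′ : Graph m} →
    InducedIso G S H → H ≅ H′ → InducedIso G S H′
  InducedIso-resp-≅ {S = S} {H} {H′} (φ , φ-inj , φ∈S , φ-onto , φ-adj) (f , g , gf , fg , f-adj) =
    φ ∘ g , φg-inj , φ∈S ∘ g , φg-onto , φg-adj
    where
    open ≡-Reasoning
    φg-inj : Injective _≡_ _≡_ (φ ∘ g)
    φg-inj {x} {y} eq = begin
      x         ≡⟨ fg x ⟨
      f (g x)   ≡⟨ cong f (φ-inj eq) ⟩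
      f (g y)   ≡⟨ fg y ⟩
      y         ∎
    φg-onto : ∀ w → lookup S w ≡ true → ∃ λ x → φ (g x) ≡ w
    φg-onto w w∈S with φ-onto w w∈S
    ... | i , φi≡w = f i , trans (cong φ (gf i)) φi≡w
    φg-adj : ∀ x y → adj G (φ (g x)) (φ (g y)) ≡ adj H′ x y
    φg-adj x y = begin
      adj G (φ (g x)) (φ (g y))   ≡⟨ φ-adj (g x) (g y) ⟩
      adj H (g x) (g y)           ≡⟨ f-adj (g x) (g y) ⟨
      adj H′ (f (g x)) (f (g y))  ≡⟨ cong₂ (adj H′) (fg x) (fg y) ⟩
      adj H′ x y                  ∎

  USNS-resp-≅ : ∀ {k m} {H : Graph k} {H′ : Graph m} → USNS G H → H ≅ H′ → USNS G H′
  USNS-resp-≅ {H = H} {H′} usns H≅H′ u v u∼v =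
    InducedIso-resp-≅ {S = common G u v} {H} {H′} (usns u v u∼v) H≅H′

  InducedIso⇒length≤ : ∀ {k} {S : Subset n} {H : Graph k} {ws : List (Fin n)} →
    InducedIso G S H → Unique ws → All (λ w → lookup S w ≡ true) ws → length ws ≤ k
  InducedIso⇒length≤ {ws = ws} (φ , _ , _ , φ-onto , _) ws-unique ws⊆S =
    injective⇒≤ preimage-injective
    where
    open ≡-Reasoning
    preimage : ∀ i → ∃ λ x → φ x ≡ List.lookup ws i
    preimage i = φ-onto (List.lookup ws i) (All.lookup ws⊆S (∈-lookup i))
    preimage-injective : Injective _≡_ _≡_ (proj₁ ∘ preimage)
    preimage-injective {i} {j} eq = Unique⇒lookup-injective ws-unique (begin
      List.lookup ws i           ≡⟨ proj₂ (preimage i) ⟨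
      φ (proj₁ (preimage i))     ≡⟨ cong φ eq ⟩
      φ (proj₁ (preimage j))     ≡⟨ proj₂ (preimage j) ⟩
      List.lookup ws j           ∎)

  InducedIso-P3-edge-extends : ∀ {S : Subset n} {v b} → InducedIso G S P3 →
    lookup S v ≡ true → lookup S b ≡ true → v ∼[ G ] b →
    ∃ λ x → lookup S x ≡ true × x ≢ v × x ≢ b × (v ∼[ G ] x ⊎ b ∼[ G ] x)
  InducedIso-P3-edge-extends (φ , φ-inj , φ∈S , φ-onto , φ-adj) v∈S b∈S v∼b
    with φ-onto _ v∈S | φ-onto _ b∈S
  ... | i , refl | j , refl
    with P3-edge-has-neighbour i j (trans (sym (φ-adj i j)) v∼b)
  ... | m , m≢i , m≢j , i∼m⊎j∼m =
    φ m , φ∈S m , m≢i ∘ φ-inj , m≢j ∘ φ-inj ,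
    Sum.map (trans (φ-adj i m)) (trans (φ-adj j m)) i∼m⊎j∼m

  USNS-P3⇒common≤3 : USNS G P3 → ∀ {u v} → u ∼[ G ] v → ∀ {ws} → Unique ws →
    All (λ w → lookup (common G u v) w ≡ true) ws → length ws ≤ 3
  USNS-P3⇒common≤3 usns {u} {v} u∼v =
    InducedIso⇒length≤ {S = common G u v} {H = P3} (usns u v u∼v)

  USNS-P3⇒edgeless : USNS G P3 → ∀ u v → ¬ u ∼[ G ] v
  USNS-P3⇒edgeless usns u v u∼v = no-induced-path (usns u v u∼v)
    where
    no-induced-path : InducedIso G (common G u v) P3 → ⊥
    no-induced-path (φ , φ-inj , φ∈S , _ , φ-adj) =
      no-extension (InducedIso-P3-edge-extends {S = common G u a} (usns u a (u∼ zero))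
        (∈-common⁺ u∼v (∼-sym (v∼ zero))) (∈-common⁺ (u∼ (suc zero)) a∼b) (v∼ (suc zero)))
      where
      a b c : Fin n
      a = φ zero
      b = φ (suc zero)
      c = φ (suc (suc zero))
      u∼ : ∀ i → u ∼[ G ] φ i
      u∼ i = proj₁ (∈-common⁻ (φ∈S i))
      v∼ : ∀ i → v ∼[ G ] φ i
      v∼ i = proj₂ (∈-common⁻ (φ∈S i))
      a∼b : a ∼[ G ] b
      a∼b = φ-adj zero (suc zero)
      b∼c : b ∼[ G ] c
      b∼c = φ-adj (suc zero) (suc (suc zero))
      a≢c : a ≢ c
      a≢c eq = contradiction (φ-inj eq) λ ()
      no-extension : (∃ λ x → lookup (common G u a) x ≡ true × x ≢ v × x ≢ b ×
                              (v ∼[ G ] x ⊎ b ∼[ G ] x)) → ⊥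
      no-extension (x , x∈N[u,a] , x≢v , x≢b , v∼x⊎b∼x) = [ v≁x , b≁x ]′ v∼x⊎b∼x
        where
        u∼x = proj₁ (∈-common⁻ x∈N[u,a])
        a∼x = proj₂ (∈-common⁻ x∈N[u,a])
        c≢x : c ≢ x
        c≢x = ≁-∼⇒≢ (φ-adj zero (suc (suc zero))) a∼x
        v≁x : ¬ v ∼[ G ] x
        v≁x v∼x = 1+n≰n (USNS-P3⇒common≤3 usns u∼v
          ((∼⇒≢ a∼b ∷ a≢c ∷ ∼⇒≢ a∼x ∷ []) ∷ (∼⇒≢ b∼c ∷ ≢-sym x≢b ∷ []) ∷ (c≢x ∷ []) ∷ [] ∷ [])
          (φ∈S zero ∷ φ∈S (suc zero) ∷ φ∈S (suc (suc zero)) ∷ ∈-common⁺ u∼x v∼x ∷ []))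
        b≁x : ¬ b ∼[ G ] x
        b≁x b∼x = 1+n≰n (USNS-P3⇒common≤3 usns (u∼ (suc zero))
          ((∼⇒≢ (v∼ zero) ∷ ∼⇒≢ (v∼ (suc (suc zero))) ∷ ≢-sym x≢v ∷ []) ∷
           (a≢c ∷ ∼⇒≢ a∼x ∷ []) ∷ (c≢x ∷ []) ∷ [] ∷ [])
          (∈-common⁺ u∼v (∼-sym (v∼ (suc zero))) ∷ ∈-common⁺ (u∼ zero) (∼-sym a∼b) ∷
           ∈-common⁺ (u∼ (suc (suc zero))) b∼c ∷ ∈-common⁺ u∼x b∼x ∷ []))

theorem1 : ∀ {n k} (d : ℕ) (G : Graph n) (H : Graph k) →
    EdgeRegular G d 3 →
    ∃₂ (λ u v → u ∼[ G ] v) →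
    USNS G H →
    ¬ (H ≅ P3)
theorem1 d G H _ (u , v , u∼v) usns H≅P3 =
  USNS-P3⇒edgeless G (USNS-resp-≅ G {H = H} {P3} usns H≅P3) u v u∼v
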